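{- Let $\Delta_n := \operatorname{conv}(0, e_1, \ldots, e_n) \subset \mathbb{R}^n$ and let $P_1, \ldots, P_k$ be faces of $\Delta_n$ such that $\dim(P_I) \ge |I|$ for every nonempty $I \subseteq [k]$. Then $\operatorname{int}_{\mathbb{Z}}(P_I) = \emptyset$ for every nonempty $I \subseteq [k]$.
   Context: $e_1,\ldots,e_n$ is the standard basis of $\mathbb{R}^n$. For $\emptyset\neq I\subseteq[k]$, $P_I:=\sum_{i\in I}P_i$ is the Minkowski sum. $\operatorname{int}_{\mathbb{Z}}(A):=\operatorname{int}(A)\cap\mathbb{Z}^n$, where $\operatorname{int}$ is the relative interior (interior with respect to the affine span; the relative interior of a point is the point itself).
   Formalization: Points and coefficients are rational, with ℚ^n in place of ℝ^n, so the faces P_1, …, P_k of $\Delta_n$, the sums P_I and their relative interiors consist of rational points. -}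

module Defs where

open import Data.Nat using (ℕ; zero; suc)
open import Data.Fin using (Fin; zero; suc)
open import Data.Bool using (Bool; true; false; if_then_else_)
open import Data.Integer using (ℤ)
open import Data.Rational using (ℚ; 0ℚ; 1ℚ; _+_; _*_; _-_; _≤_; _<_; ∣_∣; _/_)
open import Data.Empty using (⊥)
open import Data.Product using (Σ; ∃; _×_)
open import Relation.Binary.PropositionalEquality using (_≡_)

-- Points of ℚ^n (we work over ℚ instead of ℝ)
Pt : ℕ → Set
Pt n = Fin n → ℚ

Σℚ : ∀ {m} → (Fin m → ℚ) → ℚ
Σℚ {zero}  f = 0ℚ
Σℚ {suc m} f = f zero + Σℚ (λ i → f (suc i))

card : ∀ {k} → (Fin k → Bool) → ℕ
card {zero}  I = zero
card {suc k} I = (if I zero then 1 else 0) Data.Nat.+ card (λ i → I (suc i))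

Nonempty : ∀ {k} → (Fin k → Bool) → Set
Nonempty {k} I = ∃ λ (i : Fin k) → I i ≡ true

e : ∀ {n} → Fin n → Pt n
e {suc n} zero    zero    = 1ℚ
e {suc n} zero    (suc _) = 0ℚ
e {suc n} (suc j) zero    = 0ℚ
e {suc n} (suc j) (suc l) = e j l

vert : ∀ {n} → Fin (suc n) → Pt n
vert zero    = λ _ → 0ℚ
vert (suc j) = e j

Conv : ∀ {n m} → (Fin m → Pt n) → Pt n → Set
Conv {n} {m} v x =
  Σ (Fin m → ℚ) λ μ → (∀ i → 0ℚ ≤ μ i) × (Σℚ μ ≡ 1ℚ) ×
    (∀ j → x j ≡ Σℚ (λ i → μ i * v i j))

Δ : (n : ℕ) → Pt n → Set
Δ n = Conv (vert {n})

dot : ∀ {n} → Pt n → Pt n → ℚ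
dot c x = Σℚ (λ j → c j * x j)

-- F is a face of the polytope Q: F = Q ∩ H for a valid inequality c·x ≤ b
-- (c = 0, b = 0 gives Q itself; an inequality never attained gives ∅)
IsFaceOf : ∀ {n} → (Pt n → Set) → (Pt n → Set) → Set
IsFaceOf {n} Q F = Σ (Pt n) λ c → Σ ℚ λ b →
  (∀ x → Q x → dot c x ≤ b) ×
  (∀ x → F x → Q x × dot c x ≡ b) ×
  (∀ x → Q x → dot c x ≡ b → F x)

Mink : ∀ {n k} → (Fin k → Pt n → Set) → (Fin k → Bool) → Pt n → Set
Mink {n} {k} P I x = Σ (Fin k → Pt n) λ y →
  (∀ i → I i ≡ true → P i (y i)) ×
  (∀ j → x j ≡ Σℚ (λ i → if I i then y i j else 0ℚ))

AffIndep : ∀ {n d} → (Fin (suc d) → Pt n) → Set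
AffIndep {n} {d} p = ∀ (λ' : Fin (suc d) → ℚ) → Σℚ λ' ≡ 0ℚ →
  (∀ j → Σℚ (λ i → λ' i * p i j) ≡ 0ℚ) → ∀ i → λ' i ≡ 0ℚ

Dim≥ : ∀ {n} → (Pt n → Set) → ℕ → Set
Dim≥ {n} A d = Σ (Fin (suc d) → Pt n) λ p → (∀ i → A (p i)) × AffIndep p

Aff : ∀ {n} → (Pt n → Set) → Pt n → Set
Aff {n} A z = Σ ℕ λ m → Σ (Fin m → Pt n) λ q → Σ (Fin m → ℚ) λ μ →
  (∀ i → A (q i)) × (Σℚ μ ≡ 1ℚ) × (∀ j → z j ≡ Σℚ (λ i → μ i * q i j))

RelInt : ∀ {n} → (Pt n → Set) → Pt n → Set
RelInt {n} A x = A x × Σ ℚ λ ε → (0ℚ < ε) ×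
  (∀ z → Aff A z → (∀ j → ∣ z j - x j ∣ < ε) → A z)

IsLattice : ∀ {n} → Pt n → Set
IsLattice {n} x = Σ (Fin n → ℤ) λ z → ∀ j → x j ≡ (z j / 1)

IntZEmpty : ∀ {n} → (Pt n → Set) → Set
IntZEmpty A = ∀ x → IsLattice x → RelInt A x → ⊥

module Submission where

-- Every P_i, being a face of Δ_n, lies in Δ_n (this is all that
-- is used about faces), so P_I lies in D·Δ_n with D = |I|.
-- Record a point z of D·Δ_n by its barycentric coordinates
-- β(z) = (D − Σ z, z_1, …, z_n) ∈ ℚ^{n+1}: they are nonnegative, sum to D
-- and depend affinely on z.  Suppose a lattice point x lies in the relative
-- interior of P_I.  Then β(x) is a nonnegative integer vector with sum D, so
-- its support S has at most D = |I| elements.  Because x is relatively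
-- interior, every coordinate vanishing at x vanishes on all of P_I; hence the
-- |I|+1 affinely independent points of P_I given by the dimension hypothesis
-- have barycentric vectors supported on S.  More than |S| vectors supported
-- on S are linearly dependent, and a linear dependence of barycentric vectors
-- is an affine dependence of the points (since D > 0) — a contradiction.

open import Defs
open import Data.Nat as ℕ using (ℕ; zero; suc; s≤s; z≤n)
import Data.Nat.Properties as ℕP
open import Data.Integer as ℤ using (ℤ; +0; +[1+_]; -[1+_])
import Data.Integer.Properties as ℤP
open import Data.Fin using (Fin; zero; suc; punchIn)
open import Data.Fin.Properties using (all?; ¬∀⟶∃¬)
open import Data.Vec.Functional using (insertAt)
open import Data.Vec.Functional.Properties using (insertAt-lookup; insertAt-punchIn)
open import Data.Bool using (Bool; true; false; if_then_else_; not)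
open import Data.Rational
open import Data.Rational.Properties
import Data.Rational.Unnormalised as ℚᵘ
import Data.Rational.Unnormalised.Properties as ℚᵘP
open import Data.Rational.Solver
open import Data.Product using (Σ; _×_; _,_; proj₁; proj₂)
open import Data.Sum using (_⊎_; inj₁; inj₂)
open import Data.Empty using (⊥-elim)
open import Relation.Nullary using (¬_; yes; no; does)
open import Relation.Binary.PropositionalEquality
open +-*-Solver

Σ-cong : ∀ {m} {f g : Fin m → ℚ} → (∀ i → f i ≡ g i) → Σℚ f ≡ Σℚ g
Σ-cong {zero}  h = refl
Σ-cong {suc m} h = cong₂ _+_ (h zero) (Σ-cong (λ i → h (suc i)))

Σ-0 : ∀ {m} → Σℚ {m} (λ _ → 0ℚ) ≡ 0ℚ
Σ-0 {zero}  = refl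
Σ-0 {suc m} = cong (0ℚ +_) (Σ-0 {m})

Σ-+ : ∀ {m} (f g : Fin m → ℚ) → Σℚ (λ i → f i + g i) ≡ Σℚ f + Σℚ g
Σ-+ {zero}  f g = refl
Σ-+ {suc m} f g =
  trans (cong (f zero + g zero +_) (Σ-+ (λ i → f (suc i)) (λ i → g (suc i))))
        (solve 4 (λ a b c d → (a :+ b) :+ (c :+ d) := (a :+ c) :+ (b :+ d)) refl
               (f zero) (g zero) _ _)

Σ-*ˡ : ∀ {m} (c : ℚ) (f : Fin m → ℚ) → Σℚ (λ i → c * f i) ≡ c * Σℚ f
Σ-*ˡ {zero}  c f = sym (*-zeroʳ c)
Σ-*ˡ {suc m} c f =
  trans (cong (c * f zero +_) (Σ-*ˡ c (λ i → f (suc i)))) (sym (*-distribˡ-+ c _ _))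

Σ-*ʳ : ∀ {m} (c : ℚ) (f : Fin m → ℚ) → Σℚ (λ i → f i * c) ≡ Σℚ f * c
Σ-*ʳ c f = trans (Σ-cong (λ i → *-comm (f i) c)) (trans (Σ-*ˡ c f) (*-comm c _))

Σ-neg : ∀ {m} (f : Fin m → ℚ) → Σℚ (λ i → - f i) ≡ - Σℚ f
Σ-neg {zero}  f = refl
Σ-neg {suc m} f =
  trans (cong (- f zero +_) (Σ-neg (λ i → f (suc i)))) (sym (neg-distrib-+ (f zero) _))

Σ-- : ∀ {m} (f g : Fin m → ℚ) → Σℚ (λ i → f i - g i) ≡ Σℚ f - Σℚ g
Σ-- f g = trans (Σ-+ f (λ i → - g i)) (cong (Σℚ f +_) (Σ-neg g))

Σ-swap : ∀ {m k} (f : Fin m → Fin k → ℚ) →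
  Σℚ (λ i → Σℚ (λ j → f i j)) ≡ Σℚ (λ j → Σℚ (λ i → f i j))
Σ-swap {zero}  {k} f = sym (Σ-0 {k})
Σ-swap {suc m}     f =
  trans (cong (Σℚ (f zero) +_) (Σ-swap (λ i → f (suc i))))
        (sym (Σ-+ (λ j → f zero j) (λ j → Σℚ (λ i → f (suc i) j))))

Σ-nonneg : ∀ {m} (f : Fin m → ℚ) → (∀ i → 0ℚ ≤ f i) → 0ℚ ≤ Σℚ f
Σ-nonneg {zero}  f h = ≤-refl
Σ-nonneg {suc m} f h =
  +-mono-≤ {0ℚ} {f zero} {0ℚ} (h zero) (Σ-nonneg (λ i → f (suc i)) (λ i → h (suc i)))

Σ-mono : ∀ {m} (f g : Fin m → ℚ) → (∀ i → f i ≤ g i) → Σℚ f ≤ Σℚ g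
Σ-mono {zero}  f g h = ≤-refl
Σ-mono {suc m} f g h =
  +-mono-≤ (h zero) (Σ-mono (λ i → f (suc i)) (λ i → g (suc i)) (λ i → h (suc i)))

term≤Σ : ∀ {m} (f : Fin m → ℚ) → (∀ i → 0ℚ ≤ f i) → ∀ j → f j ≤ Σℚ f
term≤Σ {suc m} f h zero = begin
  f zero        ≡⟨ sym (+-identityʳ _) ⟩
  f zero + 0ℚ   ≤⟨ +-monoʳ-≤ (f zero) (Σ-nonneg (λ i → f (suc i)) (λ i → h (suc i))) ⟩
  Σℚ f          ∎
  where open ≤-Reasoning
term≤Σ {suc m} f h (suc j) = begin
  f (suc j)        ≡⟨ sym (+-identityˡ _) ⟩
  0ℚ + f (suc j)   ≤⟨ +-mono-≤ (h zero) (term≤Σ (λ i → f (suc i)) (λ i → h (suc i)) j) ⟩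
  Σℚ f             ∎
  where open ≤-Reasoning

Σ-punch : ∀ {r} (a : Fin (suc r)) (g : Fin (suc r) → ℚ) →
  Σℚ g ≡ g a + Σℚ (λ b → g (punchIn a b))
Σ-punch zero g = refl
Σ-punch {suc r} (suc a) g =
  trans (cong (g zero +_) (Σ-punch a (λ i → g (suc i))))
        (solve 3 (λ x y z → x :+ (y :+ z) := y :+ (x :+ z)) refl (g zero) (g (suc a)) _)

-- The embedding ℕ → ℚ, by recursion so that it computes along `card`.
toℚ : ℕ → ℚ
toℚ zero    = 0ℚ
toℚ (suc m) = 1ℚ + toℚ m

toℚ-nonneg : ∀ m → 0ℚ ≤ toℚ m
toℚ-nonneg zero    = ≤-refl
toℚ-nonneg (suc m) = +-mono-≤ {0ℚ} {1ℚ} {0ℚ} (nonNegative⁻¹ 1ℚ) (toℚ-nonneg m)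

1≤toℚ-suc : ∀ m → 1ℚ ≤ toℚ (suc m)
1≤toℚ-suc m = begin
  1ℚ             ≡⟨ sym (+-identityʳ 1ℚ) ⟩
  1ℚ + 0ℚ        ≤⟨ +-monoʳ-≤ 1ℚ (toℚ-nonneg m) ⟩
  1ℚ + toℚ m     ∎
  where open ≤-Reasoning

toℚ-cancel-≤ : ∀ a b → toℚ a ≤ toℚ b → a ℕ.≤ b
toℚ-cancel-≤ zero    b       le = z≤n
toℚ-cancel-≤ (suc a) zero    le =
  ⊥-elim (<-irrefl refl (<-≤-trans (positive⁻¹ 1ℚ) (≤-trans (1≤toℚ-suc a) le)))
toℚ-cancel-≤ (suc a) (suc b) le = s≤s (toℚ-cancel-≤ a b (cancel1 le))
  where
  cancel1 : ∀ {p q} → 1ℚ + p ≤ 1ℚ + q → p ≤ q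
  cancel1 {p} {q} le = subst₂ _≤_ (drop1 p) (drop1 q) (+-monoʳ-≤ (- 1ℚ) le)
    where
    drop1 : ∀ y → - 1ℚ + (1ℚ + y) ≡ y
    drop1 y = solve 1 (λ y → (:- con 1ℚ) :+ (con 1ℚ :+ y) := y) refl y

Σ-indicator : ∀ {k} (I : Fin k → Bool) →
  Σℚ (λ i → if I i then 1ℚ else 0ℚ) ≡ toℚ (card I)
Σ-indicator {zero}  I = refl
Σ-indicator {suc k} I with I zero
... | true  = cong (1ℚ +_) (Σ-indicator (λ i → I (suc i)))
... | false = trans (+-identityˡ _) (Σ-indicator (λ i → I (suc i)))

card-pos : ∀ {k} (I : Fin k → Bool) → Nonempty I → 0ℚ < toℚ (card I)
card-pos {suc k} I (i , Ii) with I zero in I0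
... | true = <-≤-trans (positive⁻¹ 1ℚ) (1≤toℚ-suc (card (λ j → I (suc j))))
card-pos {suc k} I (zero  , Ii) | false with trans (sym I0) Ii
... | ()
card-pos {suc k} I (suc i , Ii) | false = card-pos (λ j → I (suc j)) (i , Ii)

card≤Σ : ∀ {m} (S : Fin m → Bool) (f : Fin m → ℚ) →
  (∀ i → 0ℚ ≤ f i) → (∀ i → S i ≡ true → 1ℚ ≤ f i) → toℚ (card S) ≤ Σℚ f
card≤Σ S f nonneg ≥1 = subst (_≤ Σℚ f) (Σ-indicator S) (Σ-mono _ _ indicator≤f)
  where
  indicator≤f : ∀ i → (if S i then 1ℚ else 0ℚ) ≤ f i
  indicator≤f i with S i in Si
  ... | true  = ≥1 i Si
  ... | false = nonneg i

Integral : ℚ → Set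
Integral q = Σ ℤ λ a → q ≡ a / 1

/1-+ : ∀ a b → (a / 1) + (b / 1) ≡ (a ℤ.+ b) / 1
/1-+ a b = toℚᵘ-injective
  (ℚᵘP.≃-trans (toℚᵘ-homo-+ (a / 1) (b / 1))
  (ℚᵘP.≃-trans (ℚᵘP.+-cong (toℚᵘ-fromℚᵘ (ℚᵘ.mkℚᵘ a 0)) (toℚᵘ-fromℚᵘ (ℚᵘ.mkℚᵘ b 0)))
  (ℚᵘP.≃-trans sumᵘ (ℚᵘP.≃-sym (toℚᵘ-fromℚᵘ (ℚᵘ.mkℚᵘ (a ℤ.+ b) 0))))))
  where
  sumᵘ : ℚᵘ.mkℚᵘ a 0 ℚᵘ.+ ℚᵘ.mkℚᵘ b 0 ℚᵘ.≃ ℚᵘ.mkℚᵘ (a ℤ.+ b) 0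
  sumᵘ = ℚᵘ.*≡* (cong (ℤ._* ℤ.+ 1) (cong₂ ℤ._+_ (ℤP.*-identityʳ a) (ℤP.*-identityʳ b)))

/1-neg : ∀ a → - (a / 1) ≡ (ℤ.- a) / 1
/1-neg a = toℚᵘ-injective
  (ℚᵘP.≃-trans (toℚᵘ-homo‿- (a / 1))
  (ℚᵘP.≃-trans (ℚᵘP.-‿cong (toℚᵘ-fromℚᵘ (ℚᵘ.mkℚᵘ a 0)))
               (ℚᵘP.≃-sym (toℚᵘ-fromℚᵘ (ℚᵘ.mkℚᵘ (ℤ.- a) 0)))))

Integral-+ : ∀ {p q} → Integral p → Integral q → Integral (p + q)
Integral-+ (a , refl) (b , refl) = a ℤ.+ b , /1-+ a b

Integral-- : ∀ {p q} → Integral p → Integral q → Integral (p - q)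
Integral-- ip (b , refl) = Integral-+ ip (ℤ.- b , /1-neg b)

Integral-Σ : ∀ {m} (f : Fin m → ℚ) → (∀ i → Integral (f i)) → Integral (Σℚ f)
Integral-Σ {zero}  f h = +0 , refl
Integral-Σ {suc m} f h = Integral-+ (h zero) (Integral-Σ (λ i → f (suc i)) (λ i → h (suc i)))

Integral-toℚ : ∀ m → Integral (toℚ m)
Integral-toℚ zero    = +0 , refl
Integral-toℚ (suc m) = Integral-+ (ℤ.+ 1 , refl) (Integral-toℚ m)

integral-gap : ∀ {q} → Integral q → 0ℚ ≤ q → q ≡ 0ℚ ⊎ 1ℚ ≤ q
integral-gap (+0 , refl) _ = inj₁ refl
integral-gap (+[1+ m ] , refl) _ = inj₂ (begin
  1ℚ                  ≡⟨ sym (+-identityʳ 1ℚ) ⟩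
  1ℚ + 0ℚ             ≤⟨ +-monoʳ-≤ 1ℚ (nonNegative⁻¹ (normalize m 1) {{normalize-nonNeg m 1}}) ⟩
  1ℚ + (ℤ.+ m / 1)    ≡⟨ /1-+ (ℤ.+ 1) (ℤ.+ m) ⟩
  +[1+ m ] / 1        ∎)
  where open ≤-Reasoning
integral-gap (-[1+ m ] , refl) 0≤q = ⊥-elim (<-irrefl refl (<-≤-trans q<0 0≤q))
  where
  q<0 : -[1+ m ] / 1 < 0ℚ
  q<0 = negative⁻¹ (-[1+ m ] / 1) {{neg-pos {normalize (suc m) 1} (normalize-pos (suc m) 1)}}

support : ∀ {m} → (Fin m → ℚ) → Fin m → Bool
support w j = not (does (w j ≟ 0ℚ))

off-support : ∀ {m} (w : Fin m → ℚ) j → support w j ≡ false → w j ≡ 0ℚ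
off-support w j outside with w j ≟ 0ℚ
... | yes wj≡0 = wj≡0
off-support w j () | no _

support-card≤Σ : ∀ {m} (w : Fin m → ℚ) → (∀ j → 0ℚ ≤ w j) → (∀ j → Integral (w j)) →
  toℚ (card (support w)) ≤ Σℚ w
support-card≤Σ w nonneg integral = card≤Σ (support w) w nonneg on-support
  where
  on-support : ∀ j → support w j ≡ true → 1ℚ ≤ w j
  on-support j inside with w j ≟ 0ℚ
  on-support j () | yes _
  ... | no wj≢0 with integral-gap (integral j) (nonneg j)
  ...   | inj₁ wj≡0 = ⊥-elim (wj≢0 wj≡0)
  ...   | inj₂ 1≤wj = 1≤wj

LinDependence : ∀ M r → (Fin r → Fin M → ℚ) → Set
LinDependence M r v = Σ (Fin r → ℚ) λ l →
  (Σ (Fin r) λ a → ¬ (l a ≡ 0ℚ)) × (∀ j → Σℚ (λ a → l a * v a j) ≡ 0ℚ)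

dependence-zero-column : ∀ {M r} (v : Fin r → Fin (suc M) → ℚ) → (∀ a → v a zero ≡ 0ℚ) →
  LinDependence M r (λ a j → v a (suc j)) → LinDependence (suc M) r v
dependence-zero-column {r = r} v col0 (l , nontrivial , rel) = l , nontrivial , λ
  { zero    → trans (Σ-cong (λ a → trans (cong (l a *_) (col0 a)) (*-zeroʳ (l a)))) (Σ-0 {r})
  ; (suc j) → rel j }

-- One step of Gaussian elimination with pivot v_a, whose first coordinate
-- has inverse K: subtracting c_b · v_a from the other vectors clears their
-- first coordinate, and relations among the reduced vectors lift back.
module Elimination {M r} (v : Fin (suc r) → Fin (suc M) → ℚ) (a : Fin (suc r))
                   (K : ℚ) (inverse : K * v a zero ≡ 1ℚ) where

  c : Fin r → ℚ
  c b = v (punchIn a b) zero * K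

  reduced : Fin r → Fin (suc M) → ℚ
  reduced b j = v (punchIn a b) j - c b * v a j

  reduced-zero : ∀ b → reduced b zero ≡ 0ℚ
  reduced-zero b = begin
    vb - vb * K * va        ≡⟨ cong (λ t → vb - t) (*-assoc vb K va) ⟩
    vb - vb * (K * va)      ≡⟨ cong (λ t → vb - vb * t) inverse ⟩
    vb - vb * 1ℚ            ≡⟨ solve 1 (λ x → x :- x :* con 1ℚ := con 0ℚ) refl vb ⟩
    0ℚ                      ∎
    where
    open ≡-Reasoning
    vb va : ℚ
    vb = v (punchIn a b) zero
    va = v a zero

  lift : (Fin r → ℚ) → Fin (suc r) → ℚ
  lift μ = insertAt μ a (- Σℚ (λ b → μ b * c b))

  lift-combination : ∀ μ j → Σℚ (λ i → lift μ i * v i j) ≡ Σℚ (λ b → μ b * reduced b j)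
  lift-combination μ j = begin
    Σℚ (λ i → lift μ i * v i j)
      ≡⟨ Σ-punch a (λ i → lift μ i * v i j) ⟩
    lift μ a * u + Σℚ (λ b → lift μ (punchIn a b) * v (punchIn a b) j)
      ≡⟨ cong₂ (λ s t → s * u + t) (insertAt-lookup μ a _)
               (Σ-cong (λ b → cong (_* v (punchIn a b) j) (insertAt-punchIn μ a _ b))) ⟩
    - X * u + Y
      ≡⟨ solve 3 (λ x y w → (:- x) :* w :+ y := y :- x :* w) refl X Y u ⟩
    Y - X * u
      ≡⟨ cong (λ t → Y - t) (sym (Σ-*ʳ u (λ b → μ b * c b))) ⟩
    Y - Σℚ (λ b → μ b * c b * u)
      ≡⟨ sym (Σ-- (λ b → μ b * v (punchIn a b) j) (λ b → μ b * c b * u)) ⟩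
    Σℚ (λ b → μ b * v (punchIn a b) j - μ b * c b * u)
      ≡⟨ Σ-cong (λ b → solve 4 (λ m x cb w → m :* x :- m :* cb :* w := m :* (x :- cb :* w))
                                refl (μ b) (v (punchIn a b) j) (c b) u) ⟩
    Σℚ (λ b → μ b * reduced b j) ∎
    where
    open ≡-Reasoning
    u X Y : ℚ
    u = v a j
    X = Σℚ (λ b → μ b * c b)
    Y = Σℚ (λ b → μ b * v (punchIn a b) j)

  lift-dependence : LinDependence M r (λ b j → reduced b (suc j)) → LinDependence (suc M) (suc r) v
  lift-dependence (μ , (b , μb≢0) , rel) =
    lift μ ,
    (punchIn a b , λ l≡0 → μb≢0 (trans (sym (insertAt-punchIn μ a _ b)) l≡0)) ,
    λ j → trans (lift-combination μ j) (column j)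
    where
    column : ∀ j → Σℚ (λ b → μ b * reduced b j) ≡ 0ℚ
    column zero    = trans (Σ-cong (λ b → trans (cong (μ b *_) (reduced-zero b)) (*-zeroʳ (μ b)))) (Σ-0 {r})
    column (suc j) = rel j

dependence-of-small-support : ∀ M r (S : Fin M → Bool) (v : Fin r → Fin M → ℚ) →
  (∀ a j → S j ≡ false → v a j ≡ 0ℚ) → card S ℕ.< r → LinDependence M r v
dependence-of-small-support zero zero    S v supp ()
dependence-of-small-support zero (suc r) S v supp _ = (λ _ → 1ℚ) , (zero , 1≢0) , λ ()
dependence-of-small-support (suc M) r S v supp few with S zero in S0
... | false = dependence-zero-column v (λ a → supp a zero S0)
                (dependence-of-small-support M r (λ j → S (suc j)) (λ a j → v a (suc j))
                   (λ a j → supp a (suc j)) few)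
... | true with all? (λ a → v a zero ≟ 0ℚ)
...   | yes col0 = dependence-zero-column v col0
                     (dependence-of-small-support M r (λ j → S (suc j)) (λ a j → v a (suc j))
                        (λ a j → supp a (suc j)) (ℕP.<-trans (ℕP.n<1+n _) few))
dependence-of-small-support (suc M) (suc r) S v supp (s≤s few) | true | no ¬col0 =
  lift-dependence (dependence-of-small-support M r (λ j → S (suc j))
                     (λ b j → reduced b (suc j)) reduced-supp few)
  where
  pivot : Σ (Fin (suc r)) λ a → ¬ (v a zero ≡ 0ℚ)
  pivot = ¬∀⟶∃¬ (suc r) _ (λ a → v a zero ≟ 0ℚ) ¬col0
  a : Fin (suc r)
  a = proj₁ pivot
  instance
    pivot-nonZero : NonZero (v a zero)
    pivot-nonZero = ≢-nonZero (proj₂ pivot)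
  open Elimination v a (1/ (v a zero)) (*-inverseˡ (v a zero))
  reduced-supp : ∀ b j → S (suc j) ≡ false → reduced b (suc j) ≡ 0ℚ
  reduced-supp b j outside
    rewrite supp (punchIn a b) (suc j) outside | supp a (suc j) outside =
    solve 1 (λ t → con 0ℚ :- t :* con 0ℚ := con 0ℚ) refl (c b)

-- Barycentric coordinates with respect to the dilated simplex D·Δ_n:
-- β_D(z) = (D − Σ z, z_1, …, z_n).
bary : ∀ {n} → ℚ → Pt n → Fin (suc n) → ℚ
bary D z zero    = D - Σℚ z
bary D z (suc j) = z j

Σ-bary : ∀ {n} D (z : Pt n) → Σℚ (bary D z) ≡ D
Σ-bary D z = solve 2 (λ d s → (d :- s) :+ s := d) refl D (Σℚ z)

IsAffine : ∀ {n} → (Pt n → ℚ) → Set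
IsAffine {n} φ = ∀ t (x y : Pt n) → φ (λ j → x j + t * (x j - y j)) ≡ φ x + t * (φ x - φ y)

bary-affine : ∀ {n} D (j' : Fin (suc n)) → IsAffine (λ z → bary D z j')
bary-affine D (suc j) t x y = refl
bary-affine D zero    t x y = begin
  D - Σℚ (λ j → x j + t * (x j - y j))  ≡⟨ cong (λ u → D - u) Σ-step ⟩
  D - (Σℚ x + t * (Σℚ x - Σℚ y))       ≡⟨ solve 4 (λ d a b s → d :- (a :+ s :* (a :- b))
                                                    := (d :- a) :+ s :* ((d :- a) :- (d :- b)))
                                                  refl D (Σℚ x) (Σℚ y) t ⟩
  (D - Σℚ x) + t * ((D - Σℚ x) - (D - Σℚ y)) ∎
  where
  open ≡-Reasoning
  Σ-step : Σℚ (λ j → x j + t * (x j - y j)) ≡ Σℚ x + t * (Σℚ x - Σℚ y)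
  Σ-step = trans (Σ-+ x (λ j → t * (x j - y j)))
                 (cong (Σℚ x +_) (trans (Σ-*ˡ t (λ j → x j - y j)) (cong (t *_) (Σ-- x y))))

bary-relation⇒affine-relation : ∀ {n r} D (p : Fin r → Pt n) (l : Fin r → ℚ) → 0ℚ < D →
  (∀ j' → Σℚ (λ a → l a * bary D (p a) j') ≡ 0ℚ) →
  Σℚ l ≡ 0ℚ × (∀ j → Σℚ (λ a → l a * p a j) ≡ 0ℚ)
bary-relation⇒affine-relation {n} {r} D p l 0<D rel = cancel-D , (λ j → rel (suc j))
  where
  instance
    D-positive : Positive D
    D-positive = positive 0<D
    D-nonZero : NonZero D
    D-nonZero = pos⇒nonZero D
  s : Fin r → ℚ
  s a = Σℚ (p a)
  Σls≡0 : Σℚ (λ a → l a * s a) ≡ 0ℚ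
  Σls≡0 = begin
    Σℚ (λ a → l a * s a)               ≡⟨ sym (Σ-cong (λ a → Σ-*ˡ (l a) (p a))) ⟩
    Σℚ (λ a → Σℚ (λ j → l a * p a j))  ≡⟨ Σ-swap (λ a j → l a * p a j) ⟩
    Σℚ (λ j → Σℚ (λ a → l a * p a j))  ≡⟨ Σ-cong (λ j → rel (suc j)) ⟩
    Σℚ {n} (λ _ → 0ℚ)                  ≡⟨ Σ-0 {n} ⟩
    0ℚ                                 ∎
    where open ≡-Reasoning
  ΣlD≡0 : Σℚ l * D ≡ 0ℚ
  ΣlD≡0 = begin
    Σℚ l * D                        ≡⟨ sym (Σ-*ʳ D l) ⟩
    Σℚ (λ a → l a * D)              ≡⟨ Σ-cong (λ a → solve 3 (λ u d w → u :* d := u :* (d :- w) :+ u :* w)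
                                                            refl (l a) D (s a)) ⟩
    Σℚ (λ a → l a * (D - s a) + l a * s a)
                                    ≡⟨ Σ-+ (λ a → l a * (D - s a)) (λ a → l a * s a) ⟩
    Σℚ (λ a → l a * (D - s a)) + Σℚ (λ a → l a * s a)
                                    ≡⟨ cong₂ _+_ (rel zero) Σls≡0 ⟩
    0ℚ + 0ℚ                         ≡⟨ +-identityʳ 0ℚ ⟩
    0ℚ                              ∎
    where open ≡-Reasoning
  cancel-D : Σℚ l ≡ 0ℚ
  cancel-D = begin
    Σℚ l                 ≡⟨ sym (*-identityʳ (Σℚ l)) ⟩
    Σℚ l * 1ℚ            ≡⟨ cong (Σℚ l *_) (sym (*-inverseʳ D)) ⟩
    Σℚ l * (D * 1/ D)    ≡⟨ sym (*-assoc (Σℚ l) D (1/ D)) ⟩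
    Σℚ l * D * 1/ D      ≡⟨ cong (_* 1/ D) ΣlD≡0 ⟩
    0ℚ * 1/ D            ≡⟨ *-zeroˡ (1/ D) ⟩
    0ℚ                   ∎
    where open ≡-Reasoning

face⊆ : ∀ {n} {Q F : Pt n → Set} → IsFaceOf Q F → ∀ y → F y → Q y
face⊆ (_ , _ , _ , F⇒Q∩H , _) y Fy = proj₁ (F⇒Q∩H y Fy)

Σ-e : ∀ {n} (f : Fin n → ℚ) (j : Fin n) → Σℚ (λ k → f k * e k j) ≡ f j
Σ-e {suc n} f zero = begin
  f zero * 1ℚ + Σℚ (λ k → f (suc k) * 0ℚ)
    ≡⟨ cong₂ _+_ (*-identityʳ (f zero)) (trans (Σ-cong (λ k → *-zeroʳ (f (suc k)))) (Σ-0 {n})) ⟩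
  f zero + 0ℚ  ≡⟨ +-identityʳ _ ⟩
  f zero       ∎
  where open ≡-Reasoning
Σ-e {suc n} f (suc j) =
  trans (cong₂ _+_ (*-zeroʳ (f zero)) (Σ-e (λ k → f (suc k)) j)) (+-identityˡ _)

Σ-vert : ∀ {n} (μ : Fin (suc n) → ℚ) (j : Fin n) → Σℚ (λ k → μ k * vert k j) ≡ μ (suc j)
Σ-vert μ j = trans (cong₂ _+_ (*-zeroʳ (μ zero)) (Σ-e (λ k → μ (suc k)) j)) (+-identityˡ _)

Δ-bounds : ∀ {n} (y : Pt n) → Δ n y → (∀ j → 0ℚ ≤ y j) × Σℚ y ≤ 1ℚ
Δ-bounds {n} y (μ , μ≥0 , Σμ≡1 , y≡) = (λ j → subst (0ℚ ≤_) (sym (y≡μ j)) (μ≥0 (suc j))) , Σy≤1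
  where
  y≡μ : ∀ j → y j ≡ μ (suc j)
  y≡μ j = trans (y≡ j) (Σ-vert μ j)
  Σy≤1 : Σℚ y ≤ 1ℚ
  Σy≤1 = begin
    Σℚ y                           ≡⟨ Σ-cong y≡μ ⟩
    Σℚ (λ j → μ (suc j))           ≡⟨ sym (+-identityˡ _) ⟩
    0ℚ + Σℚ (λ j → μ (suc j))      ≤⟨ +-monoˡ-≤ (Σℚ (λ j → μ (suc j))) (μ≥0 zero) ⟩
    Σℚ μ                           ≡⟨ Σμ≡1 ⟩
    1ℚ                             ∎
    where open ≤-Reasoning

Mink-bounds : ∀ {n k} (P : Fin k → Pt n → Set) → (∀ i y → P i y → Δ n y) → (I : Fin k → Bool) →
  ∀ z → Mink P I z → (∀ j → 0ℚ ≤ z j) × Σℚ z ≤ toℚ (card I)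
Mink-bounds {n} {k} P P⊆Δ I z (y , Py , z≡) =
  (λ j → subst (0ℚ ≤_) (sym (z≡ j)) (Σ-nonneg _ (λ i → g≥0 i j))) , Σz≤card
  where
  g : Fin k → Fin n → ℚ
  g i j = if I i then y i j else 0ℚ
  g≥0 : ∀ i j → 0ℚ ≤ g i j
  g≥0 i j with I i in Ii
  ... | true  = proj₁ (Δ-bounds (y i) (P⊆Δ i (y i) (Py i Ii))) j
  ... | false = ≤-refl
  Σg≤indicator : ∀ i → Σℚ (g i) ≤ (if I i then 1ℚ else 0ℚ)
  Σg≤indicator i with I i in Ii
  ... | true  = proj₂ (Δ-bounds (y i) (P⊆Δ i (y i) (Py i Ii)))
  ... | false = ≤-reflexive (Σ-0 {n})
  Σz≤card : Σℚ z ≤ toℚ (card I)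
  Σz≤card = begin
    Σℚ z                                   ≡⟨ Σ-cong z≡ ⟩
    Σℚ (λ j → Σℚ (λ i → g i j))            ≡⟨ sym (Σ-swap g) ⟩
    Σℚ (λ i → Σℚ (g i))                    ≤⟨ Σ-mono _ _ Σg≤indicator ⟩
    Σℚ (λ i → if I i then 1ℚ else 0ℚ)      ≡⟨ Σ-indicator I ⟩
    toℚ (card I)                           ∎
    where open ≤-Reasoning

Mink-bary-nonneg : ∀ {n k} (P : Fin k → Pt n → Set) → (∀ i y → P i y → Δ n y) → (I : Fin k → Bool) →
  ∀ z → Mink P I z → ∀ j' → 0ℚ ≤ bary (toℚ (card I)) z j'
Mink-bary-nonneg P P⊆Δ I z Mz zero =
  subst (_≤ toℚ (card I) - Σℚ z) (+-inverseʳ (Σℚ z))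
        (+-monoˡ-≤ (- Σℚ z) (proj₂ (Mink-bounds P P⊆Δ I z Mz)))
Mink-bary-nonneg P P⊆Δ I z Mz (suc j) = proj₁ (Mink-bounds P P⊆Δ I z Mz) j

small-step : ∀ ε M → 0ℚ < ε → 0ℚ ≤ M → Σ ℚ λ t → 0ℚ < t × t * M < ε
small-step ε M 0<ε 0≤M = t , positive⁻¹ t , tM<ε
  where
  M<1+M : M < 1ℚ + M
  M<1+M = subst (_< 1ℚ + M) (+-identityˡ M) (+-monoˡ-< M (positive⁻¹ 1ℚ))
  instance
    ε-positive : Positive ε
    ε-positive = positive 0<ε
    1+M-positive : Positive (1ℚ + M)
    1+M-positive = positive (≤-<-trans 0≤M M<1+M)
    1+M-nonZero : NonZero (1ℚ + M)
    1+M-nonZero = pos⇒nonZero (1ℚ + M)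
    1/[1+M]-positive : Positive (1/ (1ℚ + M))
    1/[1+M]-positive = 1/pos⇒pos (1ℚ + M)
  t : ℚ
  t = ε * 1/ (1ℚ + M)
  instance
    t-positive : Positive t
    t-positive = pos*pos⇒pos ε (1/ (1ℚ + M))
  tM<ε : t * M < ε
  tM<ε = begin-strict
    t * M                     <⟨ *-monoʳ-<-pos t M<1+M ⟩
    t * (1ℚ + M)              ≡⟨ *-assoc ε _ _ ⟩
    ε * (1/ (1ℚ + M) * (1ℚ + M)) ≡⟨ cong (ε *_) (*-inverseˡ (1ℚ + M)) ⟩
    ε * 1ℚ                    ≡⟨ *-identityʳ ε ⟩
    ε                         ∎
    where open ≤-Reasoning

relint-extension : ∀ {n} (A : Pt n → Set) (x y : Pt n) → RelInt A x → A y →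
  Σ ℚ λ t → 0ℚ < t × A (λ j → x j + t * (x j - y j))
relint-extension {n} A x y (Ax , ε , 0<ε , ball) Ay = t , 0<t , ball z z∈aff z-near
  where
  M : ℚ
  M = Σℚ (λ j → ∣ x j - y j ∣)
  step : Σ ℚ λ t → 0ℚ < t × t * M < ε
  step = small-step ε M 0<ε (Σ-nonneg _ (λ j → 0≤∣p∣ (x j - y j)))
  t : ℚ
  t = proj₁ step
  0<t : 0ℚ < t
  0<t = proj₁ (proj₂ step)
  instance
    t-nonNegative : NonNegative t
    t-nonNegative = pos⇒nonNeg t {{positive 0<t}}
  z : Pt n
  z j = x j + t * (x j - y j)
  -- z = (1 + t)·x + (−t)·y is an affine combination of points of A
  z∈aff : Aff A z
  z∈aff = 2 , (λ { zero → x ; (suc zero) → y }) , (λ { zero → 1ℚ + t ; (suc zero) → - t }) ,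
          (λ { zero → Ax ; (suc zero) → Ay }) ,
          solve 1 (λ s → (con 1ℚ :+ s) :+ ((:- s) :+ con 0ℚ) := con 1ℚ) refl t ,
          λ j → solve 3 (λ a b s → a :+ s :* (a :- b) := (con 1ℚ :+ s) :* a :+ ((:- s) :* b :+ con 0ℚ))
                        refl (x j) (y j) t
  z-near : ∀ j → ∣ z j - x j ∣ < ε
  z-near j = begin-strict
    ∣ z j - x j ∣          ≡⟨ cong ∣_∣ (solve 3 (λ a b s → a :+ s :* (a :- b) :- a := s :* (a :- b))
                                               refl (x j) (y j) t) ⟩
    ∣ t * (x j - y j) ∣    ≡⟨ ∣p*q∣≡∣p∣*∣q∣ t _ ⟩
    ∣ t ∣ * ∣ x j - y j ∣  ≡⟨ cong (_* ∣ x j - y j ∣) (0≤p⇒∣p∣≡p (<⇒≤ 0<t)) ⟩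
    t * ∣ x j - y j ∣      ≤⟨ *-monoˡ-≤-nonNeg t (term≤Σ (λ i → ∣ x i - y i ∣) (λ i → 0≤∣p∣ (x i - y i)) j) ⟩
    t * M                  <⟨ proj₂ (proj₂ step) ⟩
    ε                      ∎
    where open ≤-Reasoning

relint-zero-propagates : ∀ {n} (A : Pt n → Set) (φ : Pt n → ℚ) → IsAffine φ →
  (∀ z → A z → 0ℚ ≤ φ z) → ∀ x y → RelInt A x → A y → φ x ≡ 0ℚ → φ y ≡ 0ℚ
relint-zero-propagates A φ affine φ≥0 x y x∈relint Ay φx≡0 = ≤-antisym φy≤0 (φ≥0 y Ay)
  where
  extension : Σ ℚ λ t → 0ℚ < t × A (λ j → x j + t * (x j - y j))
  extension = relint-extension A x y x∈relint Ay
  t : ℚ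
  t = proj₁ extension
  instance
    t-positive : Positive t
    t-positive = positive (proj₁ (proj₂ extension))
  -- φ(x + t(x − y)) = −t·φ(y) is nonnegative
  0≤-tφy : 0ℚ ≤ 0ℚ + t * (0ℚ - φ y)
  0≤-tφy = subst (0ℚ ≤_) (trans (affine t x y) (cong (λ u → u + t * (u - φ y)) φx≡0))
                 (φ≥0 _ (proj₂ (proj₂ extension)))
  φy≤0 : φ y ≤ 0ℚ
  φy≤0 = *-cancelˡ-≤-pos t (begin
    t * φ y                             ≡⟨ sym (+-identityʳ _) ⟩
    t * φ y + 0ℚ                        ≤⟨ +-monoʳ-≤ (t * φ y) 0≤-tφy ⟩
    t * φ y + (0ℚ + t * (0ℚ - φ y))     ≡⟨ solve 2 (λ a b → a :* b :+ (con 0ℚ :+ a :* (con 0ℚ :- b))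
                                                     := a :* con 0ℚ) refl t (φ y) ⟩
    t * 0ℚ                              ∎)
    where open ≤-Reasoning

bary-integral : ∀ {n} m (x : Pt n) → IsLattice x → ∀ j' → Integral (bary (toℚ m) x j')
bary-integral m x (a , x≡a) zero    = Integral-- (Integral-toℚ m) (Integral-Σ x (λ j → a j , x≡a j))
bary-integral m x (a , x≡a) (suc j) = a j , x≡a j

lemma3p8 : (n k : ℕ) (P : Fin k → Pt n → Set) →
    (∀ i → IsFaceOf (Δ n) (P i)) →
    (∀ (I : Fin k → Bool) → Nonempty I → Dim≥ (Mink P I) (card I)) →
    ∀ (I : Fin k → Bool) → Nonempty I → IntZEmpty (Mink P I)
lemma3p8 n k P faces dim I nonempty x x-lattice x∈relint =
  l≢0 (independent l (proj₁ affine-relation) (proj₂ affine-relation) a)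
  where
  D : ℚ
  D = toℚ (card I)
  β≥0 : ∀ z → Mink P I z → ∀ j' → 0ℚ ≤ bary D z j'
  β≥0 = Mink-bary-nonneg P (λ i → face⊆ (faces i)) I
  -- β(x) is nonnegative, integral and sums to |I|, so its support S has at most |I| elements
  S : Fin (suc n) → Bool
  S = support (bary D x)
  few : card S ℕ.< suc (card I)
  few = s≤s (toℚ-cancel-≤ (card S) (card I)
          (subst (toℚ (card S) ≤_) (Σ-bary D x)
            (support-card≤Σ (bary D x) (β≥0 x (proj₁ x∈relint)) (bary-integral (card I) x x-lattice))))
  -- the |I| + 1 affinely independent points p_a of P_I have β(p_a) supported on S
  p : Fin (suc (card I)) → Pt n
  p = proj₁ (dim I nonempty)
  independent : AffIndep p
  independent = proj₂ (proj₂ (dim I nonempty))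
  supported : ∀ a j' → S j' ≡ false → bary D (p a) j' ≡ 0ℚ
  supported a j' outside =
    relint-zero-propagates (Mink P I) (λ z → bary D z j') (bary-affine D j') (λ z Mz → β≥0 z Mz j')
      x (p a) x∈relint (proj₁ (proj₂ (dim I nonempty)) a) (off-support (bary D x) j' outside)
  -- so the β(p_a) are linearly dependent, i.e. the p_a are affinely dependent
  dependence : LinDependence (suc n) (suc (card I)) (λ a → bary D (p a))
  dependence = dependence-of-small-support (suc n) (suc (card I)) S (λ a → bary D (p a)) supported few
  l : Fin (suc (card I)) → ℚ
  l = proj₁ dependence
  a : Fin (suc (card I))
  a = proj₁ (proj₁ (proj₂ dependence))
  l≢0 : ¬ (l a ≡ 0ℚ)
  l≢0 = proj₂ (proj₁ (proj₂ dependence))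
  affine-relation : Σℚ l ≡ 0ℚ × (∀ j → Σℚ (λ b → l b * p b j) ≡ 0ℚ)
  affine-relation = bary-relation⇒affine-relation D p l (card-pos I nonempty) (proj₂ (proj₂ dependence))
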